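{- Let $(f,s)\colon(\gamma,x_0)\to(\delta,y_0)$ be a based cellular morphism between based cellular automata $\gamma\colon X\to CX$, $\delta\colon Y\to CY$. Then $s\colon X^*\to Y^*$ is a logical transport $(\gamma,x_0)\rightsquigarrow(\delta,y_0)$, i.e. for every modal formula $\varphi$ and every $c\in X^*$: $(\gamma,x_0,c)\models\varphi$ iff $(\delta,y_0,s(c))\models\varphi$.
   Context: Fix a monoid $(M,\cdot,e)$, a subset $N\subseteq M$ with inclusion $i\colon N\hookrightarrow M$, and a set $S$ of states. $[A,B]$ is the set of maps $A\to B$. For $a\colon M\to X$ let $I^a\subseteq[N,S]$ be the set of $f\colon N\to S$ with $f(n)=f(n')$ whenever $a(i(n))=a(i(n'))$; for $h\colon X\to Y$, $I^{h\circ a}\subseteq I^a$. Let $CX=\coprod_{a\colon M\to X}[I^a,S]$, $(Ch)(a,f)=(h\circ a, f|_{I^{h\circ a}})$. A cellular automaton is $\gamma\colon X\to CX$, $\gamma(x)=(\gamma_1(x),\gamma_2(x))$ with $\gamma_1(x)\colon M\to X$, $\gamma_2(x)\colon I^{\gamma_1(x)}\to S$, such that $\gamma_1(x)(e)=x$ and $\gamma_1(\gamma_1(x)(m))(n)=\gamma_1(x)(n\cdot m)$. A pre-cellular morphism $h\colon\gamma\to\delta$ is a map with $Ch\circ\gamma=\delta\circ h$. Configurations: $X^*=[X,S]$; $h^*(c)=c\circ h$. Global rule $G_\gamma(c)(x)=\gamma_2(x)(c\circ\gamma_1(x)\circ i)$. A cellular morphism $\gamma\to\delta$ is a pair $(f,s)$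 with $f\colon X\to Y$ pre-cellular and $s\colon X^*\to Y^*$ satisfying $f^*\circ s=\mathrm{id}$; it is based $(\gamma,x_0)\to(\delta,y_0)$ if $f(x_0)=y_0$. Modal formulas: $\varphi::=s\mid\neg\varphi\mid\bigvee_{j\in J}\varphi_j\mid\langle m\rangle\varphi\mid\bigcirc\varphi$ ($s\in S$, $m\in M$, $J$ arbitrary index set). Semantics: $(\gamma,x,c)\models s$ iff $c(x)=s$; $\neg,\bigvee$ classical; $(\gamma,x,c)\models\langle m\rangle\varphi$ iff $(\gamma,\gamma_1(x)(m),c)\models\varphi$; $(\gamma,x,c)\models\bigcirc\varphi$ iff $(\gamma,x,G_\gamma(c))\models\varphi$. -}

module Defs where

open import Data.Product using (Σ; _,_; proj₁; proj₂; Σ-syntax)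
open import Relation.Binary.PropositionalEquality using (_≡_; cong; trans; sym)
open import Algebra.Structures using (IsMonoid)
open import Function.Definitions using (Injective)
open import Function.Base using (_∘_)
open import Function.Bundles using (_⇔_)
open import Relation.Nullary using (¬_)

-- The standing data: a monoid (M,·,e), a subset N ⊆ M given by its
-- (injective) inclusion i, and a set S of states.
record Setting : Set₁ where
  field
    M           : Set
    _·_         : M → M → M
    e           : M
    isMonoid    : IsMonoid _≡_ _·_ e
    N           : Set
    i           : N → M
    i-injective : Injective _≡_ _≡_ i
    S           : Set

module _ (𝒮 : Setting) where
  open Setting 𝒮

  I : {X : Set} → (M → X) → Set
  I a = Σ[ f ∈ (N → S) ] (∀ n n' → a (i n) ≡ a (i n') → f n ≡ f n')

  restrict : {X Y : Set} (h : X → Y) (a : M → X) → I (h ∘ a) → I a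
  restrict h a (f , p) = f , λ n n' eq → p n n' (cong h eq)

  Conf : Set → Set
  Conf X = X → S

  -- a cellular automaton γ : X → CX, γ(x) = (γ₁ x , γ₂ x)
  record CA (X : Set) : Set where
    field
      γ₁     : X → M → X
      γ₂     : (x : X) → I (γ₁ x) → S
      -- γ₂ x is a map on the *set* I^{γ₁ x} of functions: it only depends
      -- on the underlying function (extensionally)
      γ₂-ext : ∀ x (f g : I (γ₁ x)) → (∀ n → proj₁ f n ≡ proj₁ g n) →
               γ₂ x f ≡ γ₂ x g
      unit   : ∀ x → γ₁ x e ≡ x
      mult   : ∀ x m n → γ₁ (γ₁ x m) n ≡ γ₁ x (n · m)

  open CA

  G : {X : Set} → CA X → Conf X → Conf X
  G γ c x = γ₂ γ x ((c ∘ γ₁ γ x ∘ i) , λ n n' eq → cong c eq)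

  -- pre-cellular morphism h : γ → δ, i.e. Ch ∘ γ = δ ∘ h, unfolded:
  -- first components h ∘ γ₁ x = δ₁ (h x) (pointwise), and second components
  -- (γ₂ x)|_{I^{h∘γ₁ x}} = δ₂ (h x) on I^{δ₁ (h x)} = I^{h∘γ₁ x}.
  record PreCellular {X Y : Set} (γ : CA X) (δ : CA Y) (h : X → Y) : Set where
    field
      comm₁ : ∀ x m → h (γ₁ γ x m) ≡ γ₁ δ (h x) m
    toI : ∀ x → I (γ₁ δ (h x)) → I (h ∘ γ₁ γ x)
    toI x (f , p) = f , λ n n' eq →
      p n n' (trans (sym (comm₁ x (i n))) (trans eq (comm₁ x (i n'))))
    field
      comm₂ : ∀ x (g : I (γ₁ δ (h x))) →
              γ₂ γ x (restrict h (γ₁ γ x) (toI x g)) ≡ γ₂ δ (h x) g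

  record BasedCellularMorphism {X Y : Set} (γ : CA X) (x₀ : X)
                               (δ : CA Y) (y₀ : Y) : Set where
    field
      f           : X → Y
      f-cellular  : PreCellular γ δ f
      s           : Conf X → Conf Y
      section     : ∀ c x → s c (f x) ≡ c x
      based       : f x₀ ≡ y₀

  data Formula : Set₁ where
    st  : S → Formula
    ¬'_ : Formula → Formula
    ⋁   : (J : Set) → (J → Formula) → Formula
    ⟨_⟩_ : M → Formula → Formula
    ○_  : Formula → Formula

  Sat : {X : Set} → CA X → X → Conf X → Formula → Set
  Sat γ x c (st s)    = c x ≡ s
  Sat γ x c (¬' φ)    = ¬ Sat γ x c φ
  Sat γ x c (⋁ J φs)  = Σ[ j ∈ J ] Sat γ x c (φs j)
  Sat γ x c (⟨ m ⟩ φ) = Sat γ (γ₁ γ x m) c φ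
  Sat γ x c (○ φ)     = Sat γ x (G γ c) φ

  LogicalTransport : {X Y : Set} → CA X → X → CA Y → Y →
                     (Conf X → Conf Y) → Set₁
  LogicalTransport {X} γ x₀ δ y₀ s =
    ∀ (φ : Formula) (c : Conf X) → Sat γ x₀ c φ ⇔ Sat δ y₀ (s c) φ

{-# OPTIONS --safe #-}
module Submission where

open import Defs
open import Data.Product using (_,_)
open import Data.Product.Function.Dependent.Propositional using (congˡ)
open import Function.Base using (_∘_)
open import Function.Bundles using (_⇔_; mk⇔)
import Function.Properties.Equivalence as ⇔
open import Function.Related.TypeIsomorphisms using (¬-cong-⇔)
open import Relation.Binary.PropositionalEquality
  using (_≡_; _≗_; refl; sym; trans; cong; module ≡-Reasoning)

-- Whenever f* d = c, the global rules of γ and δ are again related by f*: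
-- the neighbourhood of f x is the f-image of that of x, and γ₂ x agrees with
-- δ₂ (f x) on it. Satisfaction sees a configuration only through its states,
-- neighbourhoods and the global rule, so (γ, x, c) and (δ, f x, d) satisfy
-- the same formulas. The section s of f* provides d = s c for every c.

module _ (𝒮 : Setting) where
  open Setting 𝒮
  open CA

  Sat-cong-point : {Z : Set} (ε : CA 𝒮 Z) {z z′ : Z} (d : Conf 𝒮 Z) (φ : Formula 𝒮) →
                   z ≡ z′ → Sat 𝒮 ε z d φ ⇔ Sat 𝒮 ε z′ d φ
  Sat-cong-point ε d φ refl = ⇔.refl

  module _ {X Y : Set} {γ : CA 𝒮 X} {δ : CA 𝒮 Y} {f : X → Y}
           (f-cellular : PreCellular 𝒮 γ δ f) where
    open PreCellular f-cellular

    G-natural : {c : Conf 𝒮 X} {d : Conf 𝒮 Y} →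
                d ∘ f ≗ c → G 𝒮 δ d ∘ f ≗ G 𝒮 γ c
    G-natural {c} {d} d∘f≗c x = begin
      γ₂ δ (f x) local-d                                  ≡⟨ sym (comm₂ x local-d) ⟩
      γ₂ γ x (restrict 𝒮 f (γ₁ γ x) (toI x local-d))    ≡⟨ γ₂-ext γ x _ _ local-d≗local-c ⟩
      G 𝒮 γ c x                                           ∎
      where
        open ≡-Reasoning
        local-d : I 𝒮 (γ₁ δ (f x))
        local-d = d ∘ γ₁ δ (f x) ∘ i , λ n n′ eq → cong d eq
        local-d≗local-c : ∀ n → d (γ₁ δ (f x) (i n)) ≡ c (γ₁ γ x (i n))
        local-d≗local-c n = trans (cong d (sym (comm₁ x (i n)))) (d∘f≗c (γ₁ γ x (i n)))

    Sat-transport : (φ : Formula 𝒮) (c : Conf 𝒮 X) (d : Conf 𝒮 Y) → d ∘ f ≗ c →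
                    ∀ x → Sat 𝒮 γ x c φ ⇔ Sat 𝒮 δ (f x) d φ
    Sat-transport (st s)    c d d∘f≗c x = mk⇔ (trans (d∘f≗c x)) (trans (sym (d∘f≗c x)))
    Sat-transport (¬' φ)    c d d∘f≗c x = ¬-cong-⇔ (Sat-transport φ c d d∘f≗c x)
    Sat-transport (⋁ J φs)  c d d∘f≗c x = congˡ (Sat-transport (φs _) c d d∘f≗c x)
    Sat-transport (⟨ m ⟩ φ) c d d∘f≗c x =
      ⇔.trans (Sat-transport φ c d d∘f≗c (γ₁ γ x m)) (Sat-cong-point δ d φ (comm₁ x m))
    Sat-transport (○ φ)     c d d∘f≗c x =
      Sat-transport φ (G 𝒮 γ c) (G 𝒮 δ d) (G-natural d∘f≗c) x

theorem1 : (𝒮 : Setting) {X Y : Set} (γ : CA 𝒮 X) (δ : CA 𝒮 Y) (x₀ : X) (y₀ : Y)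
    (φ : BasedCellularMorphism 𝒮 γ x₀ δ y₀) →
    LogicalTransport 𝒮 γ x₀ δ y₀ (BasedCellularMorphism.s φ)
theorem1 𝒮 γ δ x₀ y₀ morphism ψ c =
  ⇔.trans (Sat-transport 𝒮 f-cellular ψ c (s c) (section c) x₀)
          (Sat-cong-point 𝒮 δ (s c) ψ based)
  where open BasedCellularMorphism morphism
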